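{- Let $X_n$ be one of the sets $SE_n$, $A_n$, $R_n$, $S_n$. Let $s=s_1\ldots s_n$ and $t=t_1\ldots t_n$ be in $X_n$, where $t$ is the successor of $s$ in $X_n$ with respect to $\prec$ (the smallest element of $X_n$ that is larger than $s$ in $\prec$ order), and let $k$ be the leftmost position where $s$ and $t$ differ. Then $s_k=t_k+1$ or $s_k=t_k-1$.
   Context: All sequences are finite sequences of non-negative integers. Statistics of $s_1\ldots s_k$: $\mathrm{len}=k-1$; $\mathrm{asc}=\#\{i<k: s_i<s_{i+1}\}$; $\max=\max_i s_i$; $\mathrm{lv}=s_k$. For a statistic $\mathrm{st}$, an $\mathrm{st}$-restricted growth sequence $s_1\ldots s_n$ satisfies $s_1=0$ and $0\le s_{k+1}\le \mathrm{st}(s_1\ldots s_k)+1$ for $1\le k<n$. $SE_n,A_n,R_n,S_n$ are the sets of length-$n$ $\mathrm{st}$-restricted growth sequences for $\mathrm{st}=\mathrm{len},\mathrm{asc},\max,\mathrm{lv}$ respectively. Reflected Gray Code order: $s\prec t$ if, with $k$ the leftmost position where they differ, either $\sum_{i=1}^{k-1}s_i$ is even and $s_k<t_k$, or it is odd and $s_k>t_k$. -}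

module Defs where

open import Data.Nat using (ℕ; zero; suc; _+_; _∸_; _≤_; _<_; _⊔_; _%_; _<?_)
open import Data.Empty using (⊥)
open import Relation.Nullary using (yes; no)
open import Data.List using (List; []; _∷_; _++_; [_]; length)
open import Data.Product using (Σ; _×_)
open import Data.Sum using (_⊎_)
open import Data.Unit using (⊤)
open import Relation.Binary.PropositionalEquality using (_≡_)

lenSt : List ℕ → ℕ
lenSt s = length s ∸ 1

ascStep : ℕ → ℕ → ℕ
ascStep x y with x <? y
... | yes _ = 1
... | no  _ = 0

ascSt : List ℕ → ℕ
ascSt []           = 0
ascSt (x ∷ [])     = 0
ascSt (x ∷ y ∷ xs) = ascStep x y + ascSt (y ∷ xs)

maxSt : List ℕ → ℕ
maxSt []       = 0
maxSt (x ∷ xs) = x ⊔ maxSt xs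

lvSt : List ℕ → ℕ
lvSt []           = 0
lvSt (x ∷ [])     = x
lvSt (x ∷ y ∷ xs) = lvSt (y ∷ xs)

data Family : Set where
  SE A R S : Family

stat : Family → List ℕ → ℕ
stat SE = lenSt
stat A  = ascSt
stat R  = maxSt
stat S  = lvSt

Growth : (List ℕ → ℕ) → List ℕ → List ℕ → Set
Growth st p []       = ⊤
Growth st p (x ∷ xs) = (x ≤ suc (st p)) × Growth st (p ++ [ x ]) xs

IsRGS : (List ℕ → ℕ) → List ℕ → Set
IsRGS st []       = ⊥
IsRGS st (x ∷ xs) = (x ≡ 0) × Growth st (x ∷ []) xs

InX : Family → ℕ → List ℕ → Set
InX F n s = (length s ≡ n) × IsRGS (stat F) s

-- Reflected Gray Code order, with accumulator = sum of the common prefix.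
-- s ≺ t iff at the leftmost differing position k: prefix sum even and s_k < t_k,
-- or prefix sum odd and s_k > t_k.
GrayLt : ℕ → List ℕ → List ℕ → Set
GrayLt acc []       _        = ⊥
GrayLt acc (x ∷ xs) []       = ⊥
GrayLt acc (x ∷ xs) (y ∷ ys) =
    ((x ≡ y) × GrayLt (acc + x) xs ys)
  ⊎ ((acc % 2 ≡ 0) × x < y)
  ⊎ ((acc % 2 ≡ 1) × y < x)

_≺_ : List ℕ → List ℕ → Set
s ≺ t = GrayLt 0 s t

IsSuccessor : Family → ℕ → List ℕ → List ℕ → Set
IsSuccessor F n s t =
  InX F n t × (s ≺ t) × ((u : List ℕ) → InX F n u → s ≺ u → (t ≡ u) ⊎ (t ≺ u))

-- If t is the successor of s and they first differ at position k with |s_k − t_k| ≥ 2,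
-- replace s_k by the value c strictly between s_k and t_k that is adjacent to s_k in the
-- direction dictated by the parity of the prefix sum, and fill the rest with zeros. This
-- sequence u is still restricted growth (c is bounded by max(s_k, t_k), and zeros are
-- always allowed), and s ≺ u ≺ t, contradicting minimality of t.
module Submission where

open import Defs
open import Data.Nat using (ℕ; zero; suc; _+_; _≤_; _<_; _%_; z≤n)
open import Data.Nat.Properties
  using (≤-trans; <⇒≤; <-irrefl; <-asym; n<1+n; m≤n⇒m<n∨m≡n)
open import Data.List using (List; []; _∷_; _++_; [_]; length; replicate)
open import Data.List.Properties
  using (++-identityʳ; ++-assoc; ++-cancelˡ; ∷-injectiveˡ; length-++; length-replicate)
open import Data.Sum using (_⊎_; inj₁; inj₂)
open import Data.Product using (Σ-syntax; _×_; _,_; proj₁; proj₂)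
open import Data.Empty using (⊥-elim)
open import Data.Unit using (tt)
open import Relation.Nullary using (¬_)
open import Relation.Binary.PropositionalEquality
  using (_≡_; _≢_; refl; sym; trans; cong; subst; module ≡-Reasoning)

graySum : ℕ → List ℕ → ℕ
graySum acc []       = acc
graySum acc (x ∷ xs) = graySum (acc + x) xs

-- Definitionally the last two disjuncts of GrayLt acc (a ∷ _) (b ∷ _).
GrayStep : ℕ → ℕ → ℕ → Set
GrayStep acc a b = ((acc % 2 ≡ 0) × a < b) ⊎ ((acc % 2 ≡ 1) × b < a)

GrayStep-irrefl : ∀ acc {a} → ¬ GrayStep acc a a
GrayStep-irrefl _ (inj₁ (_ , a<a)) = <-irrefl refl a<a
GrayStep-irrefl _ (inj₂ (_ , a<a)) = <-irrefl refl a<a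

GrayStep-asym : ∀ acc {a b} → GrayStep acc a b → ¬ GrayStep acc b a
GrayStep-asym _ (inj₁ (_ , a<b)) (inj₁ (_ , b<a)) = <-asym a<b b<a
GrayStep-asym _ (inj₁ (even , _)) (inj₂ (odd , _)) with trans (sym even) odd
... | ()
GrayStep-asym _ (inj₂ (odd , _)) (inj₁ (even , _)) with trans (sym even) odd
... | ()
GrayStep-asym _ (inj₂ (_ , b<a)) (inj₂ (_ , a<b)) = <-asym a<b b<a

GrayStep-adjacent-or-between : ∀ acc {a b m} → GrayStep acc a b → a ≤ m → b ≤ m →
  (a ≡ suc b) ⊎ (b ≡ suc a) ⊎
  (Σ[ c ∈ ℕ ] GrayStep acc a c × GrayStep acc c b × c ≤ m)
GrayStep-adjacent-or-between _ {a} {b} (inj₁ (even , a<b)) _ b≤m with m≤n⇒m<n∨m≡n a<b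
... | inj₂ 1+a≡b = inj₂ (inj₁ (sym 1+a≡b))
... | inj₁ 1+a<b =
  inj₂ (inj₂ (suc a , inj₁ (even , n<1+n a) , inj₁ (even , 1+a<b) , ≤-trans (<⇒≤ 1+a<b) b≤m))
GrayStep-adjacent-or-between _ {a} {b} (inj₂ (odd , b<a)) a≤m _ with m≤n⇒m<n∨m≡n b<a
... | inj₂ 1+b≡a = inj₁ (sym 1+b≡a)
... | inj₁ 1+b<a =
  inj₂ (inj₂ (suc b , inj₂ (odd , 1+b<a) , inj₂ (odd , n<1+n b) , ≤-trans (<⇒≤ 1+b<a) a≤m))

GrayLt-∷-≢ : ∀ acc {a b xs ys} → a ≢ b → GrayLt acc (a ∷ xs) (b ∷ ys) → GrayStep acc a b
GrayLt-∷-≢ _ a≢b (inj₁ (a≡b , _)) = ⊥-elim (a≢b a≡b)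
GrayLt-∷-≢ _ _   (inj₂ step)      = step

GrayLt-++⁻ : ∀ acc p {xs ys} → GrayLt acc (p ++ xs) (p ++ ys) → GrayLt (graySum acc p) xs ys
GrayLt-++⁻ acc []      lt              = lt
GrayLt-++⁻ acc (x ∷ p) (inj₁ (_ , lt)) = GrayLt-++⁻ (acc + x) p lt
GrayLt-++⁻ acc (x ∷ p) (inj₂ step)     = ⊥-elim (GrayStep-irrefl acc step)

GrayLt-++⁺ : ∀ acc p {xs ys} → GrayLt (graySum acc p) xs ys → GrayLt acc (p ++ xs) (p ++ ys)
GrayLt-++⁺ acc []      lt = lt
GrayLt-++⁺ acc (x ∷ p) lt = inj₁ (refl , GrayLt-++⁺ (acc + x) p lt)

GrayStep⇒¬≼ : ∀ acc p {b c xs ys} → GrayStep (graySum acc p) c b →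
  ¬ ((p ++ b ∷ xs ≡ p ++ c ∷ ys) ⊎ GrayLt acc (p ++ b ∷ xs) (p ++ c ∷ ys))
GrayStep⇒¬≼ acc p c≺b (inj₁ eq) rewrite ∷-injectiveˡ (++-cancelˡ p _ _ eq) =
  GrayStep-irrefl (graySum acc p) c≺b
GrayStep⇒¬≼ acc p c≺b (inj₂ lt) with GrayLt-++⁻ acc p lt
... | inj₁ (b≡c , _) rewrite b≡c = GrayStep-irrefl (graySum acc p) c≺b
... | inj₂ b≺c                   = GrayStep-asym (graySum acc p) c≺b b≺c

Growth-++⁻ : ∀ st q p {r} → Growth st q (p ++ r) → Growth st q p × Growth st (q ++ p) r
Growth-++⁻ st q []      {r} g = tt , subst (λ z → Growth st z r) (sym (++-identityʳ q)) g
Growth-++⁻ st q (x ∷ p) {r} (x≤ , g) with Growth-++⁻ st (q ++ [ x ]) p g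
... | gp , gr = (x≤ , gp) , subst (λ z → Growth st z r) (++-assoc q [ x ] p) gr

Growth-++⁺ : ∀ st q p {r} → Growth st q p → Growth st (q ++ p) r → Growth st q (p ++ r)
Growth-++⁺ st q []      {r} _        gr = subst (λ z → Growth st z r) (++-identityʳ q) gr
Growth-++⁺ st q (x ∷ p) {r} (x≤ , gp) gr =
  x≤ , Growth-++⁺ st (q ++ [ x ]) p gp (subst (λ z → Growth st z r) (sym (++-assoc q [ x ] p)) gr)

Growth-zeros : ∀ st q m → Growth st q (replicate m 0)
Growth-zeros st q zero    = tt
Growth-zeros st q (suc m) = z≤n , Growth-zeros st (q ++ [ 0 ]) m

IsRGS-entry-≤ : ∀ st x p {a s′} → IsRGS st (x ∷ p ++ a ∷ s′) → a ≤ suc (st (x ∷ p))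
IsRGS-entry-≤ st x p (_ , g) = proj₁ (proj₂ (Growth-++⁻ st [ x ] p g))

IsRGS-reset : ∀ st x p {a s′ c} m → IsRGS st (x ∷ p ++ a ∷ s′) → c ≤ suc (st (x ∷ p)) →
  IsRGS st (x ∷ p ++ c ∷ replicate m 0)
IsRGS-reset st x p m (x≡0 , g) c≤ =
  x≡0 , Growth-++⁺ st [ x ] p (proj₁ (Growth-++⁻ st [ x ] p g))
                              (c≤ , Growth-zeros st (x ∷ p ++ [ _ ]) m)

length-reset : ∀ p {a c} (s′ : List ℕ) →
  length (p ++ c ∷ replicate (length s′) 0) ≡ length (p ++ a ∷ s′)
length-reset p {a} {c} s′ = begin
  length (p ++ c ∷ replicate (length s′) 0) ≡⟨ length-++ p ⟩
  length p + suc (length (replicate (length s′) 0))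
    ≡⟨ cong (λ k → length p + suc k) (length-replicate (length s′)) ⟩
  length p + suc (length s′)                ≡⟨ sym (length-++ p) ⟩
  length (p ++ a ∷ s′)                      ∎
  where open ≡-Reasoning

successor-differs-by-one : ∀ F n x p {a b s′ t′} →
  let s = x ∷ p ++ a ∷ s′ ; t = x ∷ p ++ b ∷ t′ in
  InX F n s → IsSuccessor F n s t → a ≢ b → (a ≡ suc b) ⊎ (b ≡ suc a)
successor-differs-by-one F n x p {a} {b} {s′} {t′} (len-s , rgs-s) ((_ , rgs-t) , s≺t , minimal) a≢b
  with GrayStep-adjacent-or-between (graySum 0 (x ∷ p))
         (GrayLt-∷-≢ (graySum 0 (x ∷ p)) a≢b (GrayLt-++⁻ 0 (x ∷ p) s≺t))
         (IsRGS-entry-≤ (stat F) x p rgs-s) (IsRGS-entry-≤ (stat F) x p rgs-t)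
... | inj₁ adjacent                      = inj₁ adjacent
... | inj₂ (inj₁ adjacent)               = inj₂ adjacent
... | inj₂ (inj₂ (c , a≺c , c≺b , c≤)) =
  ⊥-elim (GrayStep⇒¬≼ 0 (x ∷ p) c≺b (minimal u (len-u , rgs-u) s≺u))
  where
  u : List ℕ
  u = x ∷ p ++ c ∷ replicate (length s′) 0
  len-u : length u ≡ n
  len-u = trans (length-reset (x ∷ p) s′) len-s
  rgs-u : IsRGS (stat F) u
  rgs-u = IsRGS-reset (stat F) x p (length s′) rgs-s c≤
  s≺u : (x ∷ p ++ a ∷ s′) ≺ u
  s≺u = GrayLt-++⁺ 0 (x ∷ p) (inj₂ a≺c)

lemma1 : (F : Family) (n : ℕ) (s t : List ℕ) →
         InX F n s → IsSuccessor F n s t →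
         (p : List ℕ) (a b : ℕ) (s′ t′ : List ℕ) →
         s ≡ p ++ (a ∷ s′) → t ≡ p ++ (b ∷ t′) → a ≢ b →
         (a ≡ suc b) ⊎ (b ≡ suc a)
lemma1 F n _ _ (_ , a≡0 , _) ((_ , b≡0 , _) , _) [] a b s′ t′ refl refl a≢b =
  ⊥-elim (a≢b (trans a≡0 (sym b≡0)))
lemma1 F n _ _ s∈X t-succ (x ∷ p) a b s′ t′ refl refl a≢b =
  successor-differs-by-one F n x p s∈X t-succ a≢b
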